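{- Let $q$ be a prime, $D\ge1$ and $S\in\mathrm{Sym}_D$. There exist $i\in\{0,1,\dots,D\}$, a matrix $\mathcal{C}\in GL(D,q)$ and a matrix $S'\in\mathrm{Sym}_{D,i}$ such that the $i\times i$ submatrix $(S')_{D-i<m,n\le D}$ has trivial kernel (i.e. is non-singular) and $\rho((\mathcal{C},0))\,W(S)=W(S')$.
   Context: Equip $\mathbb{F}_q^{2D}$ with the non-degenerate symplectic form $\mathfrak{B}$ for which $e_1,\dots,e_D,f_1,\dots,f_D$ is a symplectic basis: $\mathfrak{B}(e_i,e_j)=\mathfrak{B}(f_i,f_j)=0$, $\mathfrak{B}(e_i,f_j)=-\mathfrak{B}(f_j,e_i)=\delta_{ij}$. Let $X$ be the set of maximal isotropic subspaces of $\mathbb{F}_q^{2D}$ and $V=\mathrm{span}_{\mathbb{C}}\{|x\rangle:x\in X\}$ with $\{|x\rangle\}$ orthonormal. Put $x_i=\mathrm{span}\{e_1,\dots,e_{D-i}\}\oplus\mathrm{span}\{f_{D-i+1},\dots,f_D\}$ ($0\le i\le D$). $\mathrm{Sym}_D$ is the set of symmetric $D\times D$ matrices over $\mathbb{F}_q$, $\mathrm{Sym}_{D,i}$ those $\mathcal{F}$ with $\mathcal{F}_{mn}=0$ whenever $m\le D-i$ or $n\le D-i$. For $\mathcal{C}\in GL(D,q)$, $\mathcal{F}\in\mathrm{Sym}_D$, $(\mathcal{C},\mathcal{F})\in Sp(2D,q)$ has matrix $\begin{pmatrix}\mathcal{C}&0\\0&(\mathcal{C}^t)^{ -1}\end{pmatrix}\begin{pmatrix}I&\mathcal{F}\\0&I\end{pmatrix}$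 in the basis $(e_1,\dots,e_D,f_1,\dots,f_D)$; $g$ acts on $X$ by $gx=\{gv:v\in x\}$ and $\rho(g)|x\rangle=|gx\rangle$. For $S''\in\mathrm{Sym}_{D,j}$, $|[I],S''\rangle_j=q^{ -j(j+1)/4}\sum_{\mathcal{F}\in\mathrm{Sym}_{D,j}}e^{2\pi\sqrt{ -1}\,\mathrm{tr}(S''\mathcal{F})/q}|(I,\mathcal{F})x_j\rangle$ (elements of $\mathbb{F}_q$ in exponents identified with integers in $\{0,\dots,q-1\}$). For $T\in\mathrm{Sym}_D$ and $\mathcal{C}\in GL(D,q)$ with $\mathcal{C}^tT\mathcal{C}\in\mathrm{Sym}_{D,j}$, $|[\mathcal{C}],T\rangle_j=\rho((\mathcal{C},0))|[I],\mathcal{C}^tT\mathcal{C}\rangle_j$. $W_j(T)=\mathrm{span}_{\mathbb{C}}\{|[\mathcal{C}],T\rangle_j:\mathcal{C}^tT\mathcal{C}\in\mathrm{Sym}_{D,j}\}$ and $W(T)=\bigoplus_{j=0}^DW_j(T)$. -}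

module Defs where

open import Level using (Level; _⊔_)
open import Data.Nat as ℕ using (ℕ; zero; suc; NonZero; _∸_; _≤ᵇ_; _≡ᵇ_)
open import Data.Nat.DivMod using (_mod_)
open import Data.Fin as Fin using (Fin; toℕ)
open import Data.Bool using (Bool; true; false; if_then_else_; _∧_; _∨_)
open import Data.List as List using (List; []; _∷_)
open import Data.Product using (Σ; Σ-syntax; ∃; ∃-syntax; _×_; _,_)
open import Data.Sum using (_⊎_)
open import Relation.Binary.PropositionalEquality using (_≡_)
open import Relation.Nullary using (¬_; does)
open import Algebra.Bundles using (CommutativeRing)
open import Data.Bool.ListAction using () renaming (all to allB; any to anyB)

module FF (q : ℕ) {{nz : NonZero q}} (D : ℕ) where

  F : Set
  F = Fin q

  0F 1F : F
  0F = 0 mod q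
  1F = 1 mod q

  _+F_ _*F_ : F → F → F
  a +F b = (toℕ a ℕ.+ toℕ b) mod q
  a *F b = (toℕ a ℕ.* toℕ b) mod q

  -F_ : F → F
  -F a = (q ∸ toℕ a) mod q

  isZeroB : F → Bool
  isZeroB a = toℕ a ≡ᵇ 0

  eqFB : F → F → Bool
  eqFB a b = toℕ a ≡ᵇ toℕ b

  sumF : ∀ {n} → (Fin n → F) → F
  sumF {zero}  f = 0F
  sumF {suc n} f = f Fin.zero +F sumF (λ k → f (Fin.suc k))

  allFinB : ∀ {n} → (Fin n → Bool) → Bool
  allFinB {zero}  p = true
  allFinB {suc n} p = p Fin.zero ∧ allFinB (λ k → p (Fin.suc k))

  -- D×D matrices over F_q (indices 0-based: index k stands for k+1)
  Mat : Set
  Mat = Fin D → Fin D → F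

  Vc : Set
  Vc = Fin D → F

  _*M_ : Mat → Mat → Mat
  (A *M B) i j = sumF (λ k → A i k *F B k j)

  _*V_ : Mat → Vc → Vc
  (A *V v) i = sumF (λ k → A i k *F v k)

  _+V_ : Vc → Vc → Vc
  (u +V v) i = u i +F v i

  _ᵗ : Mat → Mat
  (A ᵗ) i j = A j i

  I : Mat
  I i j = if does (i Fin.≟ j) then 1F else 0F

  0M : Mat
  0M i j = 0F

  _≡M_ : Mat → Mat → Set
  A ≡M B = ∀ i j → A i j ≡ B i j

  tr : Mat → F
  tr A = sumF (λ i → A i i)

  record GL : Set where
    field
      mat  : Mat
      inv  : Mat
      rinv : (mat *M inv) ≡M I
      linv : (inv *M mat) ≡M I
  open GL public

  invGL : GL → GL
  invGL C = record { mat = inv C ; inv = mat C ; rinv = linv C ; linv = rinv C }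

  Sym : Mat → Set
  Sym S = ∀ m n → S m n ≡ S n m

  -- Sym_{D,i}: symmetric, and F_{mn} = 0 whenever m ≤ D-i or n ≤ D-i
  -- (1-based m,n; with 0-based indices this is toℕ m < D ∸ i)
  SymD : ℕ → Mat → Set
  SymD i S = Sym S × (∀ m n → (toℕ m ℕ.< D ∸ i ⊎ toℕ n ℕ.< D ∸ i) → S m n ≡ 0F)

  SymDB : ℕ → Mat → Bool
  SymDB i S = allFinB (λ m → allFinB (λ n →
      eqFB (S m n) (S n m)
    ∧ (if (D ∸ i ≤ᵇ toℕ m) ∧ (D ∸ i ≤ᵇ toℕ n) then true else isZeroB (S m n))))

  -- The i×i submatrix (S)_{D-i<m,n≤D} has trivial kernel: every vector w
  -- in F_q^i (embedded in the last i coordinates of F_q^D) annihilated by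
  -- that submatrix is zero.
  NonsingBlock : ℕ → Mat → Set
  NonsingBlock i S = ∀ (w : Vc)
    → (∀ n → toℕ n ℕ.< D ∸ i → w n ≡ 0F)
    → (∀ m → D ∸ i ℕ.≤ toℕ m → sumF (λ n → S m n *F w n) ≡ 0F)
    → ∀ n → w n ≡ 0F

  allF : List F
  allF = List.allFin q

  consF : ∀ {A : Set} {n} → A → (Fin n → A) → Fin (suc n) → A
  consF a f Fin.zero    = a
  consF a f (Fin.suc k) = f k

  allFuns : ∀ {A : Set} → List A → (n : ℕ) → List (Fin n → A)
  allFuns xs zero    = (λ ()) ∷ []
  allFuns xs (suc n) = List.concatMap (λ a → List.map (consF a) (allFuns xs n)) xs

  allVc : List Vc
  allVc = allFuns allF D

  allMat : List Mat
  allMat = allFuns allVc D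

  -- the symplectic space F_q^{2D}: a point is (a , b) meaning
  -- Σ a_k e_k + Σ b_k f_k
  Pt : Set
  Pt = Vc × Vc

  allPt : List Pt
  allPt = List.cartesianProduct allVc allVc

  eqVcB : Vc → Vc → Bool
  eqVcB u v = allFinB (λ k → eqFB (u k) (v k))

  eqPtB : Pt → Pt → Bool
  eqPtB (a , b) (a' , b') = eqVcB a a' ∧ eqVcB b b'

  Pred : Set
  Pred = Pt → Bool

  eqPredB : Pred → Pred → Bool
  eqPredB x y = allB (λ v → if x v then y v else (if y v then false else true)) allPt

  -- x_j = span{e_1..e_{D-j}} ⊕ span{f_{D-j+1}..f_D}
  xs : ℕ → Pred
  xs j (a , b) = allFinB (λ k → if D ∸ j ≤ᵇ toℕ k then isZeroB (a k) else isZeroB (b k))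

  -- action of (C,F) ∈ Sp(2D,q), given C and C⁻¹:
  -- (a,b) ↦ (C (a + F b) , (C^t)^{-1} b)
  act : Mat → Mat → Mat → Pt → Pt
  act C Ci Fm (a , b) = (C *V (a +V (Fm *V b))) , ((Ci ᵗ) *V b)

  img : Mat → Mat → Mat → Pred → Pred
  img C Ci Fm x w = anyB (λ v → x v ∧ eqPtB (act C Ci Fm v) w) allPt

-- The coefficient field ℂ is replaced by an
-- arbitrary field K of characteristic 0 containing a primitive q-th root of
-- unity ζ (playing e^{2πi/q}) and an element s with s^4 · q = 1 (playing
-- q^{-1/4}).

module Rep {c ℓ : Level} (K : CommutativeRing c ℓ) (ζ s : CommutativeRing.Carrier K)
           (q : ℕ) {{nz : NonZero q}} (D : ℕ) where

  open CommutativeRing K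
  open FF q D

  powK : Carrier → ℕ → Carrier
  powK x zero    = 1#
  powK x (suc n) = x * powK x n

  natK : ℕ → Carrier
  natK zero    = 0#
  natK (suc n) = 1# + natK n

  sumK : List Carrier → Carrier
  sumK = List.foldr _+_ 0#

  -- V: K-valued functions on subsets of F_q^{2D}; |x⟩ is the indicator of x
  V : Set c
  V = Pred → Carrier

  ket : Pred → V
  ket x y = if eqPredB x y then 1# else 0#

  _≈V_ : V → V → Set ℓ
  φ ≈V ψ = ∀ y → φ y ≈ ψ y

  -- ρ((C,0)) on V:  (ρ g φ)(y) = φ(g⁻¹ y) with g⁻¹ = (C⁻¹,0), so that
  -- ρ((C,0)) |x⟩ = |(C,0) x⟩
  ρC : GL → V → V
  ρC C φ y = φ (img (inv C) (mat C) 0M y)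

  -- |[I],S''⟩_j = q^{-j(j+1)/4} Σ_{F ∈ Sym_{D,j}} e^{2πi tr(S''F)/q} |(I,F) x_j⟩
  ketI : ℕ → Mat → V
  ketI j S'' y =
    powK s (j ℕ.* suc j) *
    sumK (List.map (λ Fm → powK ζ (toℕ (tr (S'' *M Fm))) * ket (img I I Fm (xs j)) y)
                   (List.filterᵇ (SymDB j) allMat))

  -- |[C],T⟩_j = ρ((C,0)) |[I], C^t T C⟩_j
  ketC : ℕ → GL → Mat → V
  ketC j C T = ρC C (ketI j (((mat C ᵗ) *M T) *M mat C))

  -- generators of W(T) = ⊕_j W_j(T)
  Gen : Mat → Set
  Gen T = Σ[ j ∈ ℕ ] (j ℕ.≤ D) × Σ[ C ∈ GL ] SymD j (((mat C ᵗ) *M T) *M mat C)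

  genV : ∀ {T} → Gen T → V
  genV {T} (j , _ , C , _) = ketC j C T

  InSpan : ∀ {A : Set} → (A → V) → V → Set (c ⊔ ℓ)
  InSpan {A} G φ = Σ[ cs ∈ List (Carrier × A) ]
    φ ≈V (λ y → sumK (List.map (λ { (k , a) → k * G a y }) cs))

  W : Mat → V → Set (c ⊔ ℓ)
  W T = InSpan (genV {T})

  ρW : GL → Mat → V → Set (c ⊔ ℓ)
  ρW C T φ = Σ[ ψ ∈ V ] W T ψ × (φ ≈V ρC C ψ)

  SameSub : (V → Set (c ⊔ ℓ)) → (V → Set (c ⊔ ℓ)) → Set (c ⊔ ℓ)
  SameSub P Q = ∀ φ → (P φ → Q φ) × (Q φ → P φ)

  -- hypotheses on (K, ζ, s) making them stand in for (ℂ, e^{2πi/q}, q^{-1/4})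
  IsFieldK : Set (c ⊔ ℓ)
  IsFieldK = (¬ (0# ≈ 1#)) × (∀ x → ¬ (x ≈ 0#) → ∃[ y ] (x * y ≈ 1#))

  CharZero : Set ℓ
  CharZero = ∀ n → ¬ (natK (suc n) ≈ 0#)

  PrimRoot : Set ℓ
  PrimRoot = (powK ζ q ≈ 1#) × (∀ k → 0 ℕ.< k → k ℕ.< q → ¬ (powK ζ k ≈ 1#))

  FourthRootInv : Set ℓ
  FourthRootInv = powK s 4 * natK q ≈ 1#

module Submission where

-- Over 𝔽_q, q prime, a symmetric S is brought by congruences S ↦ CᵗSC into a matrix supported on
-- a nonsingular trailing i×i block.  While the trailing block of T = CᵗSC has a kernel vector w ≠ 0
-- (a kernel vector of T, since the other rows vanish), replace C by CG with G invertible, its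
-- first block column equal to w and its earlier columns standard basis vectors: the matching row
-- and column of GᵗTG then vanish and the block shrinks by one.  On the representation side ρ is
-- an action, and (C⁻¹B)ᵗ(CᵗSC)(C⁻¹B) = BᵗSB shows that ρ((C⁻¹,0)) sends the generator
-- |[B],S⟩_j of W(S) to the generator |[C⁻¹B],CᵗSC⟩_j of W(CᵗSC); hence ρ((C⁻¹,0)) W(S) = W(CᵗSC).

open import Defs
open import Level using (Level; 0ℓ)
open import Algebra.Bundles using (CommutativeRing)
open import Algebra.Consequences.Propositional using (comm∧distrˡ⇒distrʳ)
open import Data.Bool using (Bool; true; false; T; if_then_else_; _∧_)
open import Data.Bool.ListAction using (and)
open import Data.Bool.Properties using (T-∧)
open import Data.Fin as Fin using (Fin; zero; suc; toℕ; fromℕ<)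
open import Data.Fin.Permutation using (Permutation; _⟨$⟩ʳ_; _⟨$⟩ˡ_; inverseʳ; inverseˡ; flip; transpose)
open import Data.Fin.Properties using (toℕ-fromℕ<; toℕ-injective; toℕ<n; all?; any?)
open import Data.List as List using (List)
open import Data.List.Membership.Propositional using (_∈_; lose; find)
open import Data.List.Membership.Propositional.Properties
  using (∈-concatMap⁺; ∈-map⁺; ∈-allFin; ∈-cartesianProduct⁺)
open import Data.List.Properties using (map-cong; map-∘)
open import Data.List.Relation.Unary.Any as Any using (here)
open import Data.List.Relation.Unary.Any.Properties using (any⁺; any⁻)
open import Data.Nat as ℕ using (ℕ; NonZero; _∸_; _%_; _<_; _≤_)
open import Data.Nat.Coprimality using (prime⇒coprime; coprime-Bézout)
open import Data.Nat.DivMod using (_mod_; %-distribˡ-+; %-distribˡ-*; m<n⇒m%n≡m; n%n≡0; m*n%n≡0; [m+kn]%n≡m%n)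
open import Data.Nat.GCD using (module Bézout)
open import Data.Nat.Primality using (Prime)
open import Data.Nat.Properties as ℕ using ()
open import Data.Product using (Σ; Σ-syntax; _×_; _,_; proj₁; proj₂)
open import Data.Sum using (_⊎_; inj₁; inj₂; [_,_]′)
open import Function using (_∘_; id; mk⇔; Equivalence)
open import Relation.Binary.Bundles using (Setoid)
open import Relation.Binary.PropositionalEquality
open import Relation.Nullary using (¬_; contradiction; does; Dec; yes; no)
open import Relation.Nullary.Decidable using (dec-true; dec-false; does-⇔; _×-dec_; _→-dec_; ¬?; decidable-stable)

module ZMod (q : ℕ) {{_ : NonZero q}} (D : ℕ) where
  open FF q D
  open ≡-Reasoning

  toℕ-mod : ∀ n → toℕ (n mod q) ≡ n % q
  toℕ-mod n = toℕ-fromℕ< _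

  mod-toℕ : ∀ (a : F) → toℕ a mod q ≡ a
  mod-toℕ a = toℕ-injective (trans (toℕ-mod _) (m<n⇒m%n≡m (toℕ<n a)))

  mod-cong : ∀ {m n} → m % q ≡ n % q → m mod q ≡ n mod q
  mod-cong {m} {n} eq = toℕ-injective (trans (toℕ-mod m) (trans eq (sym (toℕ-mod n))))

  0%q≡0 : 0 % q ≡ 0
  0%q≡0 = m*n%n≡0 0 q

  mod-+ : ∀ m n → (m ℕ.+ n) mod q ≡ (m mod q) +F (n mod q)
  mod-+ m n = toℕ-injective (begin
    toℕ ((m ℕ.+ n) mod q)                  ≡⟨ toℕ-mod _ ⟩
    (m ℕ.+ n) % q                          ≡⟨ %-distribˡ-+ m n q ⟩
    (m % q ℕ.+ n % q) % q                  ≡⟨ cong₂ (λ a b → (a ℕ.+ b) % q) (toℕ-mod m) (toℕ-mod n) ⟨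
    (toℕ (m mod q) ℕ.+ toℕ (n mod q)) % q  ≡⟨ toℕ-mod _ ⟨
    toℕ ((m mod q) +F (n mod q))           ∎)

  mod-* : ∀ m n → (m ℕ.* n) mod q ≡ (m mod q) *F (n mod q)
  mod-* m n = toℕ-injective (begin
    toℕ ((m ℕ.* n) mod q)                  ≡⟨ toℕ-mod _ ⟩
    (m ℕ.* n) % q                          ≡⟨ %-distribˡ-* m n q ⟩
    (m % q ℕ.* (n % q)) % q                ≡⟨ cong₂ (λ a b → (a ℕ.* b) % q) (toℕ-mod m) (toℕ-mod n) ⟨
    (toℕ (m mod q) ℕ.* toℕ (n mod q)) % q  ≡⟨ toℕ-mod _ ⟨
    toℕ ((m mod q) *F (n mod q))           ∎)

  +F-comm : ∀ a b → a +F b ≡ b +F a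
  +F-comm a b = cong (_mod q) (ℕ.+-comm (toℕ a) (toℕ b))

  *F-comm : ∀ a b → a *F b ≡ b *F a
  *F-comm a b = cong (_mod q) (ℕ.*-comm (toℕ a) (toℕ b))

  +F-assoc : ∀ a b c → (a +F b) +F c ≡ a +F (b +F c)
  +F-assoc a b c = begin
    (a +F b) +F c                                   ≡⟨ cong ((a +F b) +F_) (mod-toℕ c) ⟨
    (a +F b) +F (toℕ c mod q)                       ≡⟨ mod-+ (toℕ a ℕ.+ toℕ b) (toℕ c) ⟨
    (toℕ a ℕ.+ toℕ b ℕ.+ toℕ c) mod q               ≡⟨ cong (_mod q) (ℕ.+-assoc (toℕ a) (toℕ b) (toℕ c)) ⟩
    (toℕ a ℕ.+ (toℕ b ℕ.+ toℕ c)) mod q             ≡⟨ mod-+ (toℕ a) (toℕ b ℕ.+ toℕ c) ⟩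
    (toℕ a mod q) +F (b +F c)                       ≡⟨ cong (_+F (b +F c)) (mod-toℕ a) ⟩
    a +F (b +F c)                                   ∎

  *F-assoc : ∀ a b c → (a *F b) *F c ≡ a *F (b *F c)
  *F-assoc a b c = begin
    (a *F b) *F c                                   ≡⟨ cong ((a *F b) *F_) (mod-toℕ c) ⟨
    (a *F b) *F (toℕ c mod q)                       ≡⟨ mod-* (toℕ a ℕ.* toℕ b) (toℕ c) ⟨
    (toℕ a ℕ.* toℕ b ℕ.* toℕ c) mod q               ≡⟨ cong (_mod q) (ℕ.*-assoc (toℕ a) (toℕ b) (toℕ c)) ⟩
    (toℕ a ℕ.* (toℕ b ℕ.* toℕ c)) mod q             ≡⟨ mod-* (toℕ a) (toℕ b ℕ.* toℕ c) ⟩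
    (toℕ a mod q) *F (b *F c)                       ≡⟨ cong (_*F (b *F c)) (mod-toℕ a) ⟩
    a *F (b *F c)                                   ∎

  *F-distribˡ-+F : ∀ a b c → a *F (b +F c) ≡ (a *F b) +F (a *F c)
  *F-distribˡ-+F a b c = begin
    a *F (b +F c)                                   ≡⟨ cong (_*F (b +F c)) (mod-toℕ a) ⟨
    (toℕ a mod q) *F (b +F c)                       ≡⟨ mod-* (toℕ a) (toℕ b ℕ.+ toℕ c) ⟨
    (toℕ a ℕ.* (toℕ b ℕ.+ toℕ c)) mod q             ≡⟨ cong (_mod q) (ℕ.*-distribˡ-+ (toℕ a) (toℕ b) (toℕ c)) ⟩
    (toℕ a ℕ.* toℕ b ℕ.+ toℕ a ℕ.* toℕ c) mod q     ≡⟨ mod-+ (toℕ a ℕ.* toℕ b) (toℕ a ℕ.* toℕ c) ⟩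
    (a *F b) +F (a *F c)                            ∎

  +F-identityˡ : ∀ a → 0F +F a ≡ a
  +F-identityˡ a = trans (cong (0F +F_) (sym (mod-toℕ a))) (trans (sym (mod-+ 0 (toℕ a))) (mod-toℕ a))

  *F-identityˡ : ∀ a → 1F *F a ≡ a
  *F-identityˡ a = begin
    1F *F a                  ≡⟨ cong (1F *F_) (mod-toℕ a) ⟨
    1F *F (toℕ a mod q)      ≡⟨ mod-* 1 (toℕ a) ⟨
    (1 ℕ.* toℕ a) mod q      ≡⟨ cong (_mod q) (ℕ.*-identityˡ (toℕ a)) ⟩
    toℕ a mod q              ≡⟨ mod-toℕ a ⟩
    a                        ∎

  -F-inverseʳ : ∀ a → a +F (-F a) ≡ 0F
  -F-inverseʳ a = begin
    a +F (-F a)                           ≡⟨ cong (_+F (-F a)) (mod-toℕ a) ⟨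
    (toℕ a mod q) +F (-F a)               ≡⟨ mod-+ (toℕ a) (q ∸ toℕ a) ⟨
    (toℕ a ℕ.+ (q ∸ toℕ a)) mod q         ≡⟨ cong (_mod q) (ℕ.m+[n∸m]≡n (ℕ.<⇒≤ (toℕ<n a))) ⟩
    q mod q                               ≡⟨ mod-cong (trans (n%n≡0 q) (sym 0%q≡0)) ⟩
    0F                                    ∎

  +-*-commutativeRing : CommutativeRing 0ℓ 0ℓ
  +-*-commutativeRing = record
    { Carrier = F ; _≈_ = _≡_ ; _+_ = _+F_ ; _*_ = _*F_ ; -_ = -F_ ; 0# = 0F ; 1# = 1F
    ; isCommutativeRing = record
      { isRing = record
        { +-isAbelianGroup = record
          { isGroup = record
            { isMonoid = record
              { isSemigroup = record
                { isMagma = record { isEquivalence = isEquivalence ; ∙-cong = cong₂ _+F_ }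
                ; assoc = +F-assoc }
              ; identity = +F-identityˡ , λ a → trans (+F-comm a 0F) (+F-identityˡ a) }
            ; inverse = (λ a → trans (+F-comm (-F a) a) (-F-inverseʳ a)) , -F-inverseʳ
            ; ⁻¹-cong = cong -F_ }
          ; comm = +F-comm }
        ; *-cong = cong₂ _*F_
        ; *-assoc = *F-assoc
        ; *-identity = *F-identityˡ , λ a → trans (*F-comm a 1F) (*F-identityˡ a)
        ; distrib = *F-distribˡ-+F , comm∧distrˡ⇒distrʳ *F-comm *F-distribˡ-+F }
      ; *-comm = *F-comm } }

  open CommutativeRing +-*-commutativeRing using (-‿cong)
  open import Algebra.Properties.Ring (CommutativeRing.ring +-*-commutativeRing)
    using (-‿distribˡ-*; -‿involutive; +-inverseʳ-unique)

  *F-inverse : Prime q → (a : F) → ¬ a ≡ 0F → Σ[ b ∈ F ] b *F a ≡ 1F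
  *F-inverse q-prime a a≢0 with coprime-Bézout (prime⇒coprime q-prime {{ℕ.≢-nonZero toℕa≢0}} (toℕ<n a))
    where
    toℕa≢0 : ¬ toℕ a ≡ 0
    toℕa≢0 eq = a≢0 (toℕ-injective (trans eq (sym (trans (toℕ-mod 0) 0%q≡0))))
  ... | Bézout.-+ x y eq = y mod q , (begin
    (y mod q) *F a               ≡⟨ cong ((y mod q) *F_) (mod-toℕ a) ⟨
    (y mod q) *F (toℕ a mod q)   ≡⟨ mod-* y (toℕ a) ⟨
    (y ℕ.* toℕ a) mod q          ≡⟨ cong (_mod q) eq ⟨
    (1 ℕ.+ x ℕ.* q) mod q        ≡⟨ mod-cong ([m+kn]%n≡m%n 1 x q) ⟩
    1F                           ∎)
  ... | Bézout.+- x y eq = -F (y mod q) , (begin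
    (-F (y mod q)) *F a          ≡⟨ -‿distribˡ-* (y mod q) a ⟨
    -F ((y mod q) *F a)          ≡⟨ -‿cong (+-inverseʳ-unique 1F _ 1+ya≡0) ⟩
    -F (-F 1F)                   ≡⟨ -‿involutive 1F ⟩
    1F                           ∎)
    where
    1+ya≡0 : 1F +F ((y mod q) *F a) ≡ 0F
    1+ya≡0 = begin
      1F +F ((y mod q) *F a)               ≡⟨ cong (λ b → 1F +F ((y mod q) *F b)) (mod-toℕ a) ⟨
      1F +F ((y mod q) *F (toℕ a mod q))   ≡⟨ cong (1F +F_) (mod-* y (toℕ a)) ⟨
      1F +F ((y ℕ.* toℕ a) mod q)          ≡⟨ mod-+ 1 (y ℕ.* toℕ a) ⟨
      (1 ℕ.+ y ℕ.* toℕ a) mod q            ≡⟨ cong (_mod q) eq ⟩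
      (x ℕ.* q) mod q                      ≡⟨ mod-cong (trans (m*n%n≡0 x q) (sym 0%q≡0)) ⟩
      0F                                   ∎

module Matrices (q : ℕ) {{_ : NonZero q}} (D : ℕ) where
  open FF q D
  open ≡-Reasoning
  open ZMod q D
  open CommutativeRing +-*-commutativeRing using (+-identityʳ; zeroˡ; zeroʳ)
  open import Algebra.Properties.Semiring.Sum (CommutativeRing.semiring +-*-commutativeRing)
    using (sum; sum-replicate-zero; ∑-distrib-+; ∑-comm; *-distribˡ-sum; *-distribʳ-sum)
  open import Algebra.Properties.CommutativeSemigroup (CommutativeRing.*-commutativeSemigroup +-*-commutativeRing)
    using (x∙yz≈y∙xz)

  sumF≡sum : ∀ {n} (f : Fin n → F) → sumF f ≡ sum f
  sumF≡sum {ℕ.zero}  f = refl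
  sumF≡sum {ℕ.suc n} f = cong (f zero +F_) (sumF≡sum (f ∘ suc))

  sumF-cong : ∀ {n} {f g : Fin n → F} → f ≗ g → sumF f ≡ sumF g
  sumF-cong {ℕ.zero}  f≗g = refl
  sumF-cong {ℕ.suc n} f≗g = cong₂ _+F_ (f≗g zero) (sumF-cong (f≗g ∘ suc))

  sumF-zero : ∀ n → sumF {n} (λ _ → 0F) ≡ 0F
  sumF-zero n = trans (sumF≡sum {n} (λ _ → 0F)) (sum-replicate-zero n)

  sumF-distrib-+ : ∀ {n} (f g : Fin n → F) → sumF (λ k → f k +F g k) ≡ sumF f +F sumF g
  sumF-distrib-+ f g = begin
    sumF (λ k → f k +F g k)  ≡⟨ sumF≡sum (λ k → f k +F g k) ⟩
    sum (λ k → f k +F g k)   ≡⟨ ∑-distrib-+ f g ⟩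
    sum f +F sum g           ≡⟨ cong₂ _+F_ (sumF≡sum f) (sumF≡sum g) ⟨
    sumF f +F sumF g         ∎

  *F-distribˡ-sumF : ∀ {n} c (f : Fin n → F) → c *F sumF f ≡ sumF (λ k → c *F f k)
  *F-distribˡ-sumF c f = begin
    c *F sumF f              ≡⟨ cong (c *F_) (sumF≡sum f) ⟩
    c *F sum f               ≡⟨ *-distribˡ-sum c f ⟩
    sum (λ k → c *F f k)     ≡⟨ sumF≡sum (λ k → c *F f k) ⟨
    sumF (λ k → c *F f k)    ∎

  *F-distribʳ-sumF : ∀ {n} c (f : Fin n → F) → sumF f *F c ≡ sumF (λ k → f k *F c)
  *F-distribʳ-sumF c f = begin
    sumF f *F c              ≡⟨ cong (_*F c) (sumF≡sum f) ⟩
    sum f *F c               ≡⟨ *-distribʳ-sum c f ⟩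
    sum (λ k → f k *F c)     ≡⟨ sumF≡sum (λ k → f k *F c) ⟨
    sumF (λ k → f k *F c)    ∎

  sumF-comm : ∀ {m n} (f : Fin m → Fin n → F) →
              sumF (λ a → sumF (f a)) ≡ sumF (λ b → sumF (λ a → f a b))
  sumF-comm f = begin
    sumF (λ a → sumF (f a))                ≡⟨ sumF-cong (λ a → sumF≡sum (f a)) ⟩
    sumF (λ a → sum (f a))                 ≡⟨ sumF≡sum (λ a → sum (f a)) ⟩
    sum (λ a → sum (f a))                  ≡⟨ ∑-comm f ⟩
    sum (λ b → sum (λ a → f a b))          ≡⟨ sumF≡sum (λ b → sum (λ a → f a b)) ⟨
    sumF (λ b → sum (λ a → f a b))         ≡⟨ sumF-cong (λ b → sumF≡sum (λ a → f a b)) ⟨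
    sumF (λ b → sumF (λ a → f a b))        ∎

  -- At size D, δ is definitionally the identity matrix I, so the δ-lemmas apply to I.
  δ : ∀ {n} → Fin n → Fin n → F
  δ a b = if does (a Fin.≟ b) then 1F else 0F

  δ-sym : ∀ {n} (a b : Fin n) → δ a b ≡ δ b a
  δ-sym a b = cong (if_then 1F else 0F) (does-⇔ (mk⇔ sym sym) (a Fin.≟ b) (b Fin.≟ a))

  δ-diag : ∀ {n} (a : Fin n) → δ a a ≡ 1F
  δ-diag a = cong (if_then 1F else 0F) (dec-true (a Fin.≟ a) refl)

  δ-off : ∀ {n} {a b : Fin n} → a ≢ b → δ a b ≡ 0F
  δ-off {a = a} {b} a≢b = cong (if_then 1F else 0F) (dec-false (a Fin.≟ b) a≢b)

  sumF-δˡ : ∀ {n} (j : Fin n) (f : Fin n → F) → sumF (λ l → δ j l *F f l) ≡ f j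
  sumF-δˡ {ℕ.suc n} zero f = begin
    (1F *F f zero) +F sumF (λ l → 0F *F f (suc l))
      ≡⟨ cong₂ _+F_ (*F-identityˡ (f zero)) (sumF-cong (λ l → zeroˡ (f (suc l)))) ⟩
    f zero +F sumF {n} (λ _ → 0F)
      ≡⟨ cong (f zero +F_) (sumF-zero n) ⟩
    f zero +F 0F
      ≡⟨ +-identityʳ (f zero) ⟩
    f zero ∎
  sumF-δˡ {ℕ.suc n} (suc j) f = begin
    (0F *F f zero) +F sumF (λ l → δ j l *F f (suc l))
      ≡⟨ cong (_+F sumF (λ l → δ j l *F f (suc l))) (zeroˡ (f zero)) ⟩
    0F +F sumF (λ l → δ j l *F f (suc l))
      ≡⟨ +F-identityˡ _ ⟩
    sumF (λ l → δ j l *F f (suc l))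
      ≡⟨ sumF-δˡ j (f ∘ suc) ⟩
    f (suc j) ∎

  sumF-δʳ : ∀ {n} (j : Fin n) (f : Fin n → F) → sumF (λ l → f l *F δ l j) ≡ f j
  sumF-δʳ j f = trans (sumF-cong (λ l → trans (*F-comm (f l) (δ l j)) (cong (_*F f l) (δ-sym l j)))) (sumF-δˡ j f)

  col : Mat → Fin D → Vc
  col A j i = A i j

  *V-cong : ∀ {A A' u u'} → A ≡M A' → u ≗ u' → (A *V u) ≗ (A' *V u')
  *V-cong A≡A' u≗u' i = sumF-cong (λ k → cong₂ _*F_ (A≡A' i k) (u≗u' k))

  *M-cong : ∀ {A A' B B'} → A ≡M A' → B ≡M B' → (A *M B) ≡M (A' *M B')
  *M-cong A≡A' B≡B' i j = *V-cong A≡A' (λ k → B≡B' k j) i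

  *M-congˡ : ∀ A {B B'} → B ≡M B' → (A *M B) ≡M (A *M B')
  *M-congˡ A B≡B' = *M-cong {A = A} (λ _ _ → refl) B≡B'

  *M-congʳ : ∀ {A A'} B → A ≡M A' → (A *M B) ≡M (A' *M B)
  *M-congʳ B A≡A' = *M-cong {B = B} A≡A' (λ _ _ → refl)

  ᵗ-cong : ∀ {A A'} → A ≡M A' → (A ᵗ) ≡M (A' ᵗ)
  ᵗ-cong A≡A' i j = A≡A' j i

  *V-assoc : ∀ A B v → ((A *M B) *V v) ≗ (A *V (B *V v))
  *V-assoc A B v i = begin
    sumF (λ k → sumF (λ l → A i l *F B l k) *F v k)
      ≡⟨ sumF-cong (λ k → *F-distribʳ-sumF (v k) (λ l → A i l *F B l k)) ⟩
    sumF (λ k → sumF (λ l → (A i l *F B l k) *F v k))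
      ≡⟨ sumF-comm (λ k l → (A i l *F B l k) *F v k) ⟩
    sumF (λ l → sumF (λ k → (A i l *F B l k) *F v k))
      ≡⟨ sumF-cong (λ l → sumF-cong (λ k → *F-assoc (A i l) (B l k) (v k))) ⟩
    sumF (λ l → sumF (λ k → A i l *F (B l k *F v k)))
      ≡⟨ sumF-cong (λ l → *F-distribˡ-sumF (A i l) (λ k → B l k *F v k)) ⟨
    sumF (λ l → A i l *F sumF (λ k → B l k *F v k)) ∎

  *M-assoc : ∀ A B C → ((A *M B) *M C) ≡M (A *M (B *M C))
  *M-assoc A B C i j = *V-assoc A B (col C j) i

  *M-identityˡ : ∀ A → (I *M A) ≡M A
  *M-identityˡ A i j = sumF-δˡ i (col A j)

  *M-identityʳ : ∀ A → (A *M I) ≡M A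
  *M-identityʳ A i j = sumF-δʳ j (A i)

  ᵗ-*M : ∀ A B → ((A *M B) ᵗ) ≡M ((B ᵗ) *M (A ᵗ))
  ᵗ-*M A B i j = sumF-cong (λ k → *F-comm (A j k) (B k i))

  *V-distrib-+ : ∀ A u v → (A *V (λ k → u k +F v k)) ≗ (λ a → (A *V u) a +F (A *V v) a)
  *V-distrib-+ A u v a = trans (sumF-cong (λ k → *F-distribˡ-+F (A a k) (u k) (v k)))
                               (sumF-distrib-+ (λ k → A a k *F u k) (λ k → A a k *F v k))

  *V-scale : ∀ A c v → (A *V (λ k → c *F v k)) ≗ (λ a → c *F (A *V v) a)
  *V-scale A c v a = trans (sumF-cong (λ k → x∙yz≈y∙xz (A a k) c (v k)))
                           (sym (*F-distribˡ-sumF c (λ k → A a k *F v k)))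

  ≡M-setoid : Setoid 0ℓ 0ℓ
  ≡M-setoid = record
    { Carrier = Mat
    ; _≈_ = _≡M_
    ; isEquivalence = record
      { refl = λ _ _ → refl
      ; sym = λ A≡B i j → sym (A≡B i j)
      ; trans = λ A≡B B≡C i j → trans (A≡B i j) (B≡C i j) } }

module Pullback (q : ℕ) {{_ : NonZero q}} (D : ℕ) where
  open FF q D
  open Matrices q D
  open import Relation.Binary.Reasoning.Setoid ≡M-setoid

  pullback : Mat → Mat → Mat
  pullback P T = ((P ᵗ) *M T) *M P

  pullback-cong : ∀ {P P' T T'} → P ≡M P' → T ≡M T' → pullback P T ≡M pullback P' T'
  pullback-cong P≡P' T≡T' = *M-cong (*M-cong (ᵗ-cong P≡P') T≡T') P≡P'

  pullback-*M : ∀ A B T → pullback (A *M B) T ≡M pullback B (pullback A T)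
  pullback-*M A B T = begin
    (((A *M B) ᵗ) *M T) *M (A *M B)       ≈⟨ *M-congʳ (A *M B) (*M-congʳ T (ᵗ-*M A B)) ⟩
    (((B ᵗ) *M (A ᵗ)) *M T) *M (A *M B)   ≈⟨ *M-congʳ (A *M B) (*M-assoc (B ᵗ) (A ᵗ) T) ⟩
    ((B ᵗ) *M ((A ᵗ) *M T)) *M (A *M B)   ≈⟨ *M-assoc (B ᵗ) ((A ᵗ) *M T) (A *M B) ⟩
    (B ᵗ) *M (((A ᵗ) *M T) *M (A *M B))   ≈⟨ *M-congˡ (B ᵗ) (*M-assoc ((A ᵗ) *M T) A B) ⟨
    (B ᵗ) *M (pullback A T *M B)          ≈⟨ *M-assoc (B ᵗ) (pullback A T) B ⟨
    pullback B (pullback A T)             ∎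

  pullback-I : ∀ T → pullback I T ≡M T
  pullback-I T = begin
    ((I ᵗ) *M T) *M I   ≈⟨ *M-identityʳ ((I ᵗ) *M T) ⟩
    (I ᵗ) *M T          ≈⟨ *M-congʳ T (λ i j → δ-sym j i) ⟩
    I *M T              ≈⟨ *M-identityˡ T ⟩
    T                   ∎

  pullback-ᵗ : ∀ P T → (pullback P T ᵗ) ≡M pullback P (T ᵗ)
  pullback-ᵗ P T = begin
    (((P ᵗ) *M T) *M P) ᵗ      ≈⟨ ᵗ-*M ((P ᵗ) *M T) P ⟩
    (P ᵗ) *M (((P ᵗ) *M T) ᵗ)  ≈⟨ *M-congˡ (P ᵗ) (ᵗ-*M (P ᵗ) T) ⟩
    (P ᵗ) *M ((T ᵗ) *M P)      ≈⟨ *M-assoc (P ᵗ) (T ᵗ) P ⟨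
    pullback P (T ᵗ)           ∎

  pullback-sym : ∀ P {T} → Sym T → Sym (pullback P T)
  pullback-sym P {T} symT = begin
    pullback P T        ≈⟨ pullback-cong {P} (λ _ _ → refl) symT ⟩
    pullback P (T ᵗ)    ≈⟨ pullback-ᵗ P T ⟨
    pullback P T ᵗ      ∎

  SymD-resp : ∀ {j A B} → A ≡M B → SymD j A → SymD j B
  SymD-resp A≡B (symA , zeroA) =
    (λ m n → trans (sym (A≡B m n)) (trans (symA m n) (A≡B n m))) ,
    (λ m n outside → trans (sym (A≡B m n)) (zeroA m n outside))

  *M-inverse-*M : ∀ A B B' A' → (B *M B') ≡M I → (A *M A') ≡M I → ((A *M B) *M (B' *M A')) ≡M I
  *M-inverse-*M A B B' A' BB'≡I AA'≡I = begin
    (A *M B) *M (B' *M A')   ≈⟨ *M-assoc A B (B' *M A') ⟩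
    A *M (B *M (B' *M A'))   ≈⟨ *M-congˡ A (*M-assoc B B' A') ⟨
    A *M ((B *M B') *M A')   ≈⟨ *M-congˡ A (*M-congʳ A' BB'≡I) ⟩
    A *M (I *M A')           ≈⟨ *M-congˡ A (*M-identityˡ A') ⟩
    A *M A'                  ≈⟨ AA'≡I ⟩
    I                        ∎

  inv-*M-cancel : ∀ C B → (inv C *M (mat C *M B)) ≡M B
  inv-*M-cancel C B = begin
    inv C *M (mat C *M B)   ≈⟨ *M-assoc (inv C) (mat C) B ⟨
    (inv C *M mat C) *M B   ≈⟨ *M-congʳ B (linv C) ⟩
    I *M B                  ≈⟨ *M-identityˡ B ⟩
    B                       ∎

  *M-inv-cancel : ∀ C B → ((B *M inv C) *M mat C) ≡M B
  *M-inv-cancel C B = begin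
    (B *M inv C) *M mat C   ≈⟨ *M-assoc B (inv C) (mat C) ⟩
    B *M (inv C *M mat C)   ≈⟨ *M-congˡ B (linv C) ⟩
    B *M I                  ≈⟨ *M-identityʳ B ⟩
    B                       ∎

  pullback-inv : ∀ C B S → pullback (inv C *M B) (pullback (mat C) S) ≡M pullback B S
  pullback-inv C B S = begin
    pullback (inv C *M B) (pullback (mat C) S)
      ≈⟨ pullback-*M (inv C) B (pullback (mat C) S) ⟩
    pullback B (pullback (inv C) (pullback (mat C) S))
      ≈⟨ pullback-cong {B} (λ _ _ → refl) (pullback-*M (mat C) (inv C) S) ⟨
    pullback B (pullback (mat C *M inv C) S)
      ≈⟨ pullback-cong {B} (λ _ _ → refl) (pullback-cong {T = S} (rinv C) (λ _ _ → refl)) ⟩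
    pullback B (pullback I S)
      ≈⟨ pullback-cong {B} (λ _ _ → refl) (pullback-I S) ⟩
    pullback B S ∎

  infixr 9 _∘G_

  _∘G_ : GL → GL → GL
  A ∘G B = record
    { mat  = mat A *M mat B
    ; inv  = inv B *M inv A
    ; rinv = *M-inverse-*M (mat A) (mat B) (inv B) (inv A) (rinv B) (rinv A)
    ; linv = *M-inverse-*M (inv B) (inv A) (mat A) (mat B) (linv A) (linv B) }

  idG : GL
  idG = record { mat = I ; inv = I ; rinv = *M-identityˡ I ; linv = *M-identityˡ I }

module Elimination (q : ℕ) {{_ : NonZero q}} (D : ℕ) where
  open FF q D
  open ZMod q D
  open Matrices q D
  open Pullback q D
  open import Algebra.Properties.CommutativeSemigroup (CommutativeRing.*-commutativeSemigroup +-*-commutativeRing)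
    using (xy∙z≈x∙zy)
  open CommutativeRing +-*-commutativeRing using (zeroˡ; zeroʳ; +-identityʳ; *-identityʳ; +-assoc; distribʳ; -‿inverseˡ)
  open import Algebra.Properties.Ring (CommutativeRing.ring +-*-commutativeRing) using (-0#≈0#; xyx⁻¹≈y)
  open ≡-Reasoning

  permMat : Permutation D D → Mat
  permMat π a b = I a (π ⟨$⟩ʳ b)

  I-permute : ∀ (π : Permutation D D) a b → I a (π ⟨$⟩ʳ b) ≡ I (π ⟨$⟩ˡ a) b
  I-permute π a b = cong (if_then 1F else 0F) (does-⇔ (mk⇔ to from) (a Fin.≟ π ⟨$⟩ʳ b) (π ⟨$⟩ˡ a Fin.≟ b))
    where
    to : a ≡ π ⟨$⟩ʳ b → π ⟨$⟩ˡ a ≡ b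
    to refl = inverseˡ π
    from : π ⟨$⟩ˡ a ≡ b → a ≡ π ⟨$⟩ʳ b
    from refl = sym (inverseʳ π)

  permMat-*V : ∀ π u → (permMat π *V u) ≗ (u ∘ (π ⟨$⟩ˡ_))
  permMat-*V π u a = trans (sumF-cong (λ b → cong (_*F u b) (I-permute π a b))) (sumF-δˡ (π ⟨$⟩ˡ a) u)

  permMat-*M : ∀ π ρ → (permMat π *M permMat ρ) ≡M (λ a b → I a (π ⟨$⟩ʳ (ρ ⟨$⟩ʳ b)))
  permMat-*M π ρ a b = sumF-δʳ (ρ ⟨$⟩ʳ b) (permMat π a)

  permGL : Permutation D D → GL
  permGL π = record
    { mat  = permMat π
    ; inv  = permMat (flip π)
    ; rinv = λ a b → trans (permMat-*M π (flip π) a b) (cong (I a) (inverseʳ π))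
    ; linv = λ a b → trans (permMat-*M (flip π) π a b) (cong (I a) (inverseˡ π)) }

  transpose-maps : ∀ (i j : Fin D) → transpose i j ⟨$⟩ʳ i ≡ j
  transpose-maps i j rewrite dec-true (i Fin.≟ i) refl = refl

  transpose-fixes : ∀ {i j k : Fin D} → k ≢ i → k ≢ j → transpose i j ⟨$⟩ʳ k ≡ k
  transpose-fixes {i} {j} {k} k≢i k≢j
    rewrite dec-false (k Fin.≟ i) k≢i | dec-false (k Fin.≟ j) k≢j = refl

  transvection : Fin D → Vc → Mat
  transvection k x a b = I a b +F (x a *F I b k)

  transvection-col : ∀ k x {m} → m ≢ k → col (transvection k x) m ≗ col I m
  transvection-col k x {m} m≢k a = begin
    I a m +F (x a *F I m k)   ≡⟨ cong (λ e → I a m +F (x a *F e)) (δ-off m≢k) ⟩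
    I a m +F (x a *F 0F)      ≡⟨ cong (I a m +F_) (zeroʳ (x a)) ⟩
    I a m +F 0F               ≡⟨ +-identityʳ (I a m) ⟩
    I a m                     ∎

  transvection-col-pivot : ∀ k x → col (transvection k x) k ≗ (λ a → I a k +F x a)
  transvection-col-pivot k x a = trans (cong (λ e → I a k +F (x a *F e)) (δ-diag k)) (cong (I a k +F_) (*-identityʳ (x a)))

  transvection-*V : ∀ k x y → y k ≡ 0F → (transvection k x *V y) ≗ y
  transvection-*V k x y yk≡0 a = begin
    sumF (λ l → (I a l +F (x a *F I l k)) *F y l)
      ≡⟨ sumF-cong (λ l → distribʳ (y l) (I a l) (x a *F I l k)) ⟩
    sumF (λ l → (I a l *F y l) +F ((x a *F I l k) *F y l))
      ≡⟨ sumF-distrib-+ (λ l → I a l *F y l) (λ l → (x a *F I l k) *F y l) ⟩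
    sumF (λ l → I a l *F y l) +F sumF (λ l → (x a *F I l k) *F y l)
      ≡⟨ cong₂ _+F_ (sumF-δˡ a y) (sumF-cong (λ l → xy∙z≈x∙zy (x a) (I l k) (y l))) ⟩
    y a +F sumF (λ l → x a *F (y l *F I l k))
      ≡⟨ cong (y a +F_) (*F-distribˡ-sumF (x a) (λ l → y l *F I l k)) ⟨
    y a +F (x a *F sumF (λ l → y l *F I l k))
      ≡⟨ cong (λ e → y a +F (x a *F e)) (trans (sumF-δʳ k y) yk≡0) ⟩
    y a +F (x a *F 0F)
      ≡⟨ cong (y a +F_) (zeroʳ (x a)) ⟩
    y a +F 0F
      ≡⟨ +-identityʳ (y a) ⟩
    y a ∎

  transvection-inverse : ∀ k x y → y k ≡ 0F → (∀ a → x a +F y a ≡ 0F) →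
                         (transvection k x *M transvection k y) ≡M I
  transvection-inverse k x y yk≡0 x+y≡0 a b = begin
    (transvection k x *V col (transvection k y) b) a
      ≡⟨ *V-cong {transvection k x} (λ _ _ → refl) (λ l → cong (I l b +F_) (*F-comm (y l) (I b k))) a ⟩
    (transvection k x *V (λ l → I l b +F (I b k *F y l))) a
      ≡⟨ *V-distrib-+ (transvection k x) (col I b) (λ l → I b k *F y l) a ⟩
    (transvection k x *M I) a b +F (transvection k x *V (λ l → I b k *F y l)) a
      ≡⟨ cong₂ _+F_ (*M-identityʳ (transvection k x) a b) (*V-scale (transvection k x) (I b k) y a) ⟩
    (I a b +F (x a *F I b k)) +F (I b k *F (transvection k x *V y) a)
      ≡⟨ cong (λ e → (I a b +F (x a *F I b k)) +F (I b k *F e)) (transvection-*V k x y yk≡0 a) ⟩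
    (I a b +F (x a *F I b k)) +F (I b k *F y a)
      ≡⟨ cong ((I a b +F (x a *F I b k)) +F_) (*F-comm (I b k) (y a)) ⟩
    (I a b +F (x a *F I b k)) +F (y a *F I b k)
      ≡⟨ +-assoc (I a b) (x a *F I b k) (y a *F I b k) ⟩
    I a b +F ((x a *F I b k) +F (y a *F I b k))
      ≡⟨ cong (I a b +F_) (distribʳ (I b k) (x a) (y a)) ⟨
    I a b +F ((x a +F y a) *F I b k)
      ≡⟨ cong (λ e → I a b +F (e *F I b k)) (x+y≡0 a) ⟩
    I a b +F (0F *F I b k)
      ≡⟨ cong (I a b +F_) (zeroˡ (I b k)) ⟩
    I a b +F 0F
      ≡⟨ +-identityʳ (I a b) ⟩
    I a b ∎

  transvectionGL : ∀ k x → x k ≡ 0F → GL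
  transvectionGL k x xk≡0 = record
    { mat  = transvection k x
    ; inv  = transvection k (-F_ ∘ x)
    ; rinv = transvection-inverse k x (-F_ ∘ x) (trans (cong -F_ xk≡0) -0#≈0#) (-F-inverseʳ ∘ x)
    ; linv = transvection-inverse k (-F_ ∘ x) x xk≡0 (-‿inverseˡ ∘ x) }

  pullback-row-zero : ∀ {T} P m → Sym T → (∀ b → (T *V col P m) b ≡ 0F) → ∀ n → pullback P T m n ≡ 0F
  pullback-row-zero {T} P m symT TPm≡0 n = begin
    sumF (λ b → sumF (λ a → P a m *F T a b) *F P b n)  ≡⟨ sumF-cong (λ b → cong (_*F P b n) (PmT≡0 b)) ⟩
    sumF (λ b → 0F *F P b n)                            ≡⟨ sumF-cong (λ b → zeroˡ (P b n)) ⟩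
    sumF {D} (λ _ → 0F)                                 ≡⟨ sumF-zero D ⟩
    0F                                                  ∎
    where
    PmT≡0 : ∀ b → sumF (λ a → P a m *F T a b) ≡ 0F
    PmT≡0 b = trans (sumF-cong (λ a → trans (*F-comm (P a m) (T a b)) (cong (_*F P a m) (symT a b)))) (TPm≡0 b)

  -- The transposition (k p) moves the unit entry of w to position k; this makes the transvection
  -- turning column k into w ∘ π invertible.
  module _ (k p : Fin D) (w : Vc) (wp≡1 : w p ≡ 1F) where
    private
      π : Permutation D D
      π = transpose k p
      x : Vc
      x a = w (π ⟨$⟩ʳ a) +F (-F I a k)
      xk≡0 : x k ≡ 0F
      xk≡0 = trans (cong₂ (λ s t → s +F (-F t)) (trans (cong w (transpose-maps k p)) wp≡1) (δ-diag k))
                   (-F-inverseʳ 1F)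

    pivotGL : GL
    pivotGL = permGL π ∘G transvectionGL k x xk≡0

    pivotGL-col-pivot : col (mat pivotGL) k ≗ w
    pivotGL-col-pivot a = begin
      (permMat π *V col (transvection k x) k) a      ≡⟨ permMat-*V π (col (transvection k x) k) a ⟩
      transvection k x b k                           ≡⟨ transvection-col-pivot k x b ⟩
      I b k +F (w (π ⟨$⟩ʳ b) +F (-F I b k))          ≡⟨ +-assoc (I b k) (w (π ⟨$⟩ʳ b)) (-F I b k) ⟨
      (I b k +F w (π ⟨$⟩ʳ b)) +F (-F I b k)          ≡⟨ xyx⁻¹≈y (I b k) (w (π ⟨$⟩ʳ b)) ⟩
      w (π ⟨$⟩ʳ b)                                   ≡⟨ cong w (inverseʳ π) ⟩
      w a                                            ∎
      where
      b : Fin D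
      b = π ⟨$⟩ˡ a

    pivotGL-col-other : ∀ {m} → m ≢ k → m ≢ p → col (mat pivotGL) m ≗ col I m
    pivotGL-col-other {m} m≢k m≢p a = begin
      (permMat π *V col (transvection k x) m) a      ≡⟨ permMat-*V π (col (transvection k x) m) a ⟩
      transvection k x (π ⟨$⟩ˡ a) m                  ≡⟨ transvection-col k x m≢k (π ⟨$⟩ˡ a) ⟩
      I (π ⟨$⟩ˡ a) m                                 ≡⟨ I-permute π a m ⟨
      I a (π ⟨$⟩ʳ m)                                 ≡⟨ cong (I a) (transpose-fixes m≢k m≢p) ⟩
      I a m                                          ∎

  eliminate : ∀ T k → Sym T → (∀ m n → toℕ m < toℕ k → T m n ≡ 0F) →
              ∀ w → (∀ a → (T *V w) a ≡ 0F) → ∀ p → toℕ k ≤ toℕ p → (wp≡1 : w p ≡ 1F) →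
              ∀ m n → toℕ m ≤ toℕ k → pullback (mat (pivotGL k p w wp≡1)) T m n ≡ 0F
  eliminate T k symT T-rows<k≡0 w Tw≡0 p k≤p wp≡1 m n m≤k =
    pullback-row-zero (mat G) m symT kernel-column n
    where
    G : GL
    G = pivotGL k p w wp≡1
    kernel-column : ∀ b → (T *V col (mat G) m) b ≡ 0F
    kernel-column b with ℕ.m≤n⇒m<n∨m≡n m≤k
    ... | inj₁ m<k = begin
      (T *V col (mat G) m) b   ≡⟨ *V-cong {T} (λ _ _ → refl) (pivotGL-col-other k p w wp≡1 m≢k m≢p) b ⟩
      (T *M I) b m             ≡⟨ *M-identityʳ T b m ⟩
      T b m                    ≡⟨ symT b m ⟩
      T m b                    ≡⟨ T-rows<k≡0 m b m<k ⟩
      0F                       ∎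
      where
      m≢k : m ≢ k
      m≢k refl = ℕ.<-irrefl refl m<k
      m≢p : m ≢ p
      m≢p refl = ℕ.<-irrefl refl (ℕ.<-≤-trans m<k k≤p)
    ... | inj₂ m≡k with toℕ-injective m≡k
    ...   | refl = trans (*V-cong {T} (λ _ _ → refl) (pivotGL-col-pivot k p w wp≡1) b) (Tw≡0 b)

module Enumeration (q : ℕ) {{_ : NonZero q}} (D : ℕ) where
  open FF q D

  allFuns-complete : ∀ {A : Set} (xs : List A) n (f : Fin n → A) → (∀ k → f k ∈ xs) →
                     Σ[ g ∈ (Fin n → A) ] g ∈ allFuns xs n × g ≗ f
  allFuns-complete xs ℕ.zero    f f∈xs = (λ ()) , here refl , λ ()
  allFuns-complete xs (ℕ.suc n) f f∈xs with allFuns-complete xs n (f ∘ suc) (f∈xs ∘ suc)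
  ... | g , g∈ , g≗f = consF (f zero) g , cons∈ , cons≗f
    where
    cons∈ : consF (f zero) g ∈ allFuns xs (ℕ.suc n)
    cons∈ = ∈-concatMap⁺ (λ a → List.map (consF a) (allFuns xs n))
                         (Any.map (λ { refl → ∈-map⁺ (consF (f zero)) g∈ }) (f∈xs zero))
    cons≗f : consF (f zero) g ≗ f
    cons≗f zero    = refl
    cons≗f (suc k) = g≗f k

  allVc-complete : ∀ v → Σ[ g ∈ Vc ] g ∈ allVc × g ≗ v
  allVc-complete v = allFuns-complete allF D v (∈-allFin ∘ v)

  search-Vc : (P : Vc → Set) → (∀ w → Dec (P w)) → (∀ {v w} → v ≗ w → P v → P w) →
              (∀ w → ¬ P w) ⊎ Σ Vc P
  search-Vc P P? resp with Any.any? P? allVc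
  ... | yes found = inj₂ (Any.satisfied found)
  ... | no ¬found = inj₁ λ w Pw →
    let g , g∈ , g≗w = allVc-complete w in ¬found (lose g∈ (resp (sym ∘ g≗w) Pw))

module Reduction (q : ℕ) {{_ : NonZero q}} (D : ℕ) where
  open FF q D
  open ZMod q D
  open Matrices q D
  open Pullback q D
  open Elimination q D
  open Enumeration q D
  open CommutativeRing +-*-commutativeRing using (zeroˡ; zeroʳ)
  open ≡-Reasoning

  SingularWitness : ℕ → Mat → Vc → Set
  SingularWitness i T w =
    (∀ n → toℕ n < D ∸ i → w n ≡ 0F) ×
    (∀ m → D ∸ i ≤ toℕ m → (T *V w) m ≡ 0F) ×
    Σ[ p ∈ Fin D ] w p ≢ 0F

  singularWitness? : ∀ i T w → Dec (SingularWitness i T w)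
  singularWitness? i T w =
          all? (λ n → (toℕ n ℕ.<? D ∸ i) →-dec (w n Fin.≟ 0F))
    ×-dec all? (λ m → (D ∸ i ℕ.≤? toℕ m) →-dec ((T *V w) m Fin.≟ 0F))
    ×-dec any? (λ p → ¬? (w p Fin.≟ 0F))

  singularWitness-resp : ∀ i T {v w} → v ≗ w → SingularWitness i T v → SingularWitness i T w
  singularWitness-resp i T v≗w (v-outside≡0 , Tv≡0 , p , vp≢0) =
    (λ n n< → trans (sym (v≗w n)) (v-outside≡0 n n<)) ,
    (λ m m≥ → trans (sym (*V-cong {T} (λ _ _ → refl) v≗w m)) (Tv≡0 m m≥)) ,
    (p , λ wp≡0 → vp≢0 (trans (v≗w p) wp≡0))

  nonsingBlock-or-witness : ∀ i T → NonsingBlock i T ⊎ Σ Vc (SingularWitness i T)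
  nonsingBlock-or-witness i T with search-Vc (SingularWitness i T) (singularWitness? i T) (singularWitness-resp i T)
  ... | inj₂ witness = inj₂ witness
  ... | inj₁ none    = inj₁ λ w w-outside≡0 Tw≡0 n →
    decidable-stable (w n Fin.≟ 0F) (λ wn≢0 → none w (w-outside≡0 , Tw≡0 , n , wn≢0))

  block-kernel⇒kernel : ∀ {j T} → SymD j T → ∀ w → (∀ m → D ∸ j ≤ toℕ m → (T *V w) m ≡ 0F) →
                        ∀ a → (T *V w) a ≡ 0F
  block-kernel⇒kernel {j} {T} (_ , T-outside≡0) w Tw-block≡0 a with toℕ a ℕ.<? D ∸ j
  ... | yes a< = trans (sumF-cong (λ n → trans (cong (_*F w n) (T-outside≡0 a n (inj₁ a<))) (zeroˡ (w n))))
                       (sumF-zero D)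
  ... | no  a≮ = Tw-block≡0 a (ℕ.≮⇒≥ a≮)

  reduce-step : Prime q → ∀ i T → ℕ.suc i ≤ D → SymD (ℕ.suc i) T → Σ Vc (SingularWitness (ℕ.suc i) T) →
                Σ[ G ∈ GL ] SymD i (pullback (mat G) T)
  reduce-step q-prime i T i<D sd@(symT , T-outside≡0) (w , w-outside≡0 , Tw-block≡0 , p , wp≢0)
    with *F-inverse q-prime (w p) wp≢0
  ... | c , cwp≡1 = G , pullback-sym (mat G) symT , outside≡0
    where
    k : Fin D
    k = fromℕ< (ℕ.∸-monoʳ-< {D} (ℕ.s≤s ℕ.z≤n) i<D)
    toℕk : toℕ k ≡ D ∸ ℕ.suc i
    toℕk = toℕ-fromℕ< _
    T-rows<k≡0 : ∀ m n → toℕ m < toℕ k → T m n ≡ 0F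
    T-rows<k≡0 m n m<k = T-outside≡0 m n (inj₁ (subst (toℕ m <_) toℕk m<k))
    w' : Vc
    w' n = c *F w n
    Tw'≡0 : ∀ a → (T *V w') a ≡ 0F
    Tw'≡0 a = trans (*V-scale T c w a) (trans (cong (c *F_) (block-kernel⇒kernel {ℕ.suc i} sd w Tw-block≡0 a)) (zeroʳ c))
    k≤p : toℕ k ≤ toℕ p
    k≤p with toℕ p ℕ.<? D ∸ ℕ.suc i
    ... | yes p<k = contradiction (w-outside≡0 p p<k) wp≢0
    ... | no  p≮k = subst (_≤ toℕ p) (sym toℕk) (ℕ.≮⇒≥ p≮k)
    G : GL
    G = pivotGL k p w' cwp≡1
    rows≤k≡0 : ∀ m n → toℕ m ≤ toℕ k → pullback (mat G) T m n ≡ 0F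
    rows≤k≡0 = eliminate T k symT T-rows<k≡0 w' Tw'≡0 p k≤p cwp≡1
    <D∸i⇒≤k : ∀ {m} → m < D ∸ i → m ≤ toℕ k
    <D∸i⇒≤k {m} m< = subst (m ≤_) (trans (ℕ.pred[m∸n]≡m∸[1+n] D i) (sym toℕk)) (ℕ.<⇒≤pred m<)
    outside≡0 : ∀ m n → (toℕ m < D ∸ i ⊎ toℕ n < D ∸ i) → pullback (mat G) T m n ≡ 0F
    outside≡0 m n (inj₁ m<) = rows≤k≡0 m n (<D∸i⇒≤k m<)
    outside≡0 m n (inj₂ n<) = trans (pullback-sym (mat G) symT m n) (rows≤k≡0 n m (<D∸i⇒≤k n<))

  ReducedForm : Mat → Set
  ReducedForm S = Σ[ i ∈ ℕ ] i ≤ D × Σ[ C ∈ GL ] SymD i (pullback (mat C) S) × NonsingBlock i (pullback (mat C) S)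

  reduce : Prime q → ∀ S i → i ≤ D → (C : GL) → SymD i (pullback (mat C) S) → ReducedForm S
  reduce q-prime S ℕ.zero    0≤D C sd = 0 , 0≤D , C , sd , λ w w-outside≡0 _ n → w-outside≡0 n (toℕ<n n)
  reduce q-prime S (ℕ.suc i) i<D C sd =
    [ (λ nonsing → ℕ.suc i , i<D , C , sd , nonsing)
    , (λ witness → let G , sdG = reduce-step q-prime i (pullback (mat C) S) i<D sd witness in
         reduce q-prime S i (ℕ.<⇒≤ i<D) (C ∘G G) (SymD-resp {i} (λ a b → sym (pullback-*M (mat C) (mat G) S a b)) sdG))
    ]′ (nonsingBlock-or-witness (ℕ.suc i) (pullback (mat C) S))

  reduction : Prime q → ∀ S → Sym S → ReducedForm S
  reduction q-prime S symS =
    reduce q-prime S D ℕ.≤-refl idG (SymD-resp {D} (λ a b → sym (pullback-I S a b)) (symS , vacuous))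
    where
    vacuous : ∀ m n → toℕ m < D ∸ D ⊎ toℕ n < D ∸ D → S m n ≡ 0F
    vacuous m n (inj₁ m<0) = contradiction (subst (toℕ m <_) (ℕ.n∸n≡0 D) m<0) ℕ.n≮0
    vacuous m n (inj₂ n<0) = contradiction (subst (toℕ n <_) (ℕ.n∸n≡0 D) n<0) ℕ.n≮0

module Action (q : ℕ) {{_ : NonZero q}} (D : ℕ) where
  open FF q D
  open ZMod q D
  open Matrices q D
  open Enumeration q D
  open CommutativeRing +-*-commutativeRing using (zeroˡ; +-identityʳ)

  infix 4 _≈P_
  _≈P_ : Pt → Pt → Set
  (a , b) ≈P (a' , b') = a ≗ a' × b ≗ b'

  ≈P-refl : ∀ z → z ≈P z
  ≈P-refl _ = (λ _ → refl) , (λ _ → refl)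

  ≈P-sym : ∀ {z z'} → z ≈P z' → z' ≈P z
  ≈P-sym (a≗a' , b≗b') = (sym ∘ a≗a') , (sym ∘ b≗b')

  ≈P-trans : ∀ {z z' z''} → z ≈P z' → z' ≈P z'' → z ≈P z''
  ≈P-trans (a≗a' , b≗b') (a'≗a'' , b'≗b'') =
    (λ k → trans (a≗a' k) (a'≗a'' k)) , (λ k → trans (b≗b' k) (b'≗b'' k))

  allPt-complete : ∀ (z : Pt) → Σ[ z' ∈ Pt ] z' ∈ allPt × z' ≈P z
  allPt-complete (a , b) with allVc-complete a | allVc-complete b
  ... | a' , a'∈ , a'≗a | b' , b'∈ , b'≗b = (a' , b') , ∈-cartesianProduct⁺ a'∈ b'∈ , a'≗a , b'≗b

  allFinB-sound : ∀ {n} {p : Fin n → Bool} → T (allFinB p) → ∀ k → T (p k)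
  allFinB-sound {ℕ.suc n} h zero    = proj₁ (Equivalence.to T-∧ h)
  allFinB-sound {ℕ.suc n} h (suc k) = allFinB-sound (proj₂ (Equivalence.to T-∧ h)) k

  allFinB-complete : ∀ {n} {p : Fin n → Bool} → (∀ k → T (p k)) → T (allFinB p)
  allFinB-complete {ℕ.zero}  h = _
  allFinB-complete {ℕ.suc n} h = Equivalence.from T-∧ (h zero , allFinB-complete (h ∘ suc))

  eqVcB-sound : ∀ {u v} → T (eqVcB u v) → u ≗ v
  eqVcB-sound {u} {v} h k = toℕ-injective (ℕ.≡ᵇ⇒≡ (toℕ (u k)) (toℕ (v k)) (allFinB-sound h k))

  eqVcB-complete : ∀ {u v} → u ≗ v → T (eqVcB u v)
  eqVcB-complete {u} {v} u≗v = allFinB-complete (λ k → ℕ.≡⇒≡ᵇ (toℕ (u k)) (toℕ (v k)) (cong toℕ (u≗v k)))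

  eqPtB-sound : ∀ {z z'} → T (eqPtB z z') → z ≈P z'
  eqPtB-sound h = let ha , hb = Equivalence.to T-∧ h in eqVcB-sound ha , eqVcB-sound hb

  eqPtB-complete : ∀ {z z'} → z ≈P z' → T (eqPtB z z')
  eqPtB-complete (a≗a' , b≗b') = Equivalence.from T-∧ (eqVcB-complete a≗a' , eqVcB-complete b≗b')

  act-linear : ∀ X Xi a b → act X Xi 0M (a , b) ≈P (X *V a , (Xi ᵗ) *V b)
  act-linear X Xi a b = *V-cong {X} (λ _ _ → refl) a+0≗a , λ _ → refl
    where
    a+0≗a : ∀ k → a k +F (0M *V b) k ≡ a k
    a+0≗a k = trans (cong (a k +F_) (trans (sumF-cong (λ l → zeroˡ (b l))) (sumF-zero D))) (+-identityʳ (a k))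

  act-cong : ∀ {X X' Xi Xi'} → X ≡M X' → Xi ≡M Xi' → ∀ {z z'} → z ≈P z' → act X Xi 0M z ≈P act X' Xi' 0M z'
  act-cong {X} {X'} {Xi} {Xi'} X≡X' Xi≡Xi' {a , b} {a' , b'} (a≗a' , b≗b') =
    ≈P-trans (act-linear X Xi a b)
      (≈P-trans (*V-cong X≡X' a≗a' , *V-cong (ᵗ-cong Xi≡Xi') b≗b') (≈P-sym (act-linear X' Xi' a' b')))

  act-∘ : ∀ X Xi Y Yi z → act X Xi 0M (act Y Yi 0M z) ≈P act (X *M Y) (Yi *M Xi) 0M z
  act-∘ X Xi Y Yi (a , b) =
    ≈P-trans (act-cong {X} {X} {Xi} {Xi} (λ _ _ → refl) (λ _ _ → refl) (act-linear Y Yi a b))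
      (≈P-trans (act-linear X Xi (Y *V a) ((Yi ᵗ) *V b))
        (≈P-trans (sym ∘ *V-assoc X Y a , λ k → trans (sym (*V-assoc (Xi ᵗ) (Yi ᵗ) b k))
                                                       (*V-cong (λ i j → sym (ᵗ-*M Yi Xi i j)) (λ _ → refl) k))
          (≈P-sym (act-linear (X *M Y) (Yi *M Xi) a b))))

  img-witness : ∀ X Xi y z → T (img X Xi 0M y z) → Σ[ v ∈ Pt ] v ∈ allPt × T (y v) × act X Xi 0M v ≈P z
  img-witness X Xi y z h =
    let v , v∈ , yv∧eq = find (any⁻ (λ v → y v ∧ eqPtB (act X Xi 0M v) z) allPt h)
        yv , eq = Equivalence.to T-∧ yv∧eq
    in v , v∈ , yv , eqPtB-sound eq

  img-intro : ∀ X Xi y z {v} → v ∈ allPt → T (y v) → act X Xi 0M v ≈P z → T (img X Xi 0M y z)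
  img-intro X Xi y z v∈ yv eq =
    any⁺ (λ v → y v ∧ eqPtB (act X Xi 0M v) z) (lose v∈ (Equivalence.from T-∧ (yv , eqPtB-complete eq)))

  T-ext : ∀ {x y : Bool} → (T x → T y) → (T y → T x) → x ≡ y
  T-ext {false} {false} _ _ = refl
  T-ext {false} {true}  _ g = contradiction (g _) id
  T-ext {true}  {false} f _ = contradiction (f _) id
  T-ext {true}  {true}  _ _ = refl

  img-∘ : ∀ X Xi Y Yi y z → img X Xi 0M (img Y Yi 0M y) z ≡ img (X *M Y) (Yi *M Xi) 0M y z
  img-∘ X Xi Y Yi y z = T-ext to from
    where
    to : T (img X Xi 0M (img Y Yi 0M y) z) → T (img (X *M Y) (Yi *M Xi) 0M y z)
    to h =
      let v , _ , yYv , Xv≈z = img-witness X Xi (img Y Yi 0M y) z h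
          u , u∈ , yu , Yu≈v = img-witness Y Yi y v yYv
      in img-intro (X *M Y) (Yi *M Xi) y z u∈ yu (≈P-trans (≈P-sym (act-∘ X Xi Y Yi u))
                                   (≈P-trans (act-cong {X} {X} {Xi} {Xi} (λ _ _ → refl) (λ _ _ → refl) Yu≈v) Xv≈z))
    -- img only ranges over the listed points allPt, so the intermediate point is replaced by a listed copy.
    from : T (img (X *M Y) (Yi *M Xi) 0M y z) → T (img X Xi 0M (img Y Yi 0M y) z)
    from h =
      let u , u∈ , yu , XYu≈z = img-witness (X *M Y) (Yi *M Xi) y z h
          v , v∈ , v≈Yu = allPt-complete (act Y Yi 0M u)
      in img-intro X Xi (img Y Yi 0M y) z v∈ (img-intro Y Yi y v u∈ yu (≈P-sym v≈Yu))
                   (≈P-trans (act-cong {X} {X} {Xi} {Xi} (λ _ _ → refl) (λ _ _ → refl) v≈Yu)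
                             (≈P-trans (act-∘ X Xi Y Yi u) XYu≈z))

  img-cong : ∀ {X X' Xi Xi'} → X ≡M X' → Xi ≡M Xi' → ∀ y z → img X Xi 0M y z ≡ img X' Xi' 0M y z
  img-cong {X} {X'} {Xi} {Xi'} X≡X' Xi≡Xi' y z = T-ext to from
    where
    to : T (img X Xi 0M y z) → T (img X' Xi' 0M y z)
    to h = let v , v∈ , yv , Xv≈z = img-witness X Xi y z h
           in img-intro X' Xi' y z v∈ yv
                (≈P-trans (act-cong (λ i j → sym (X≡X' i j)) (λ i j → sym (Xi≡Xi' i j)) (≈P-refl v)) Xv≈z)
    from : T (img X' Xi' 0M y z) → T (img X Xi 0M y z)
    from h = let v , v∈ , yv , Xv≈z = img-witness X' Xi' y z h
             in img-intro X Xi y z v∈ yv (≈P-trans (act-cong X≡X' Xi≡Xi' (≈P-refl v)) Xv≈z)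

  eqPredB-congʳ : ∀ x {y y' : Pred} → (∀ v → y v ≡ y' v) → eqPredB x y ≡ eqPredB x y'
  eqPredB-congʳ x y≗y' =
    cong and (map-cong (λ v → cong (λ b → if x v then b else (if b then false else true)) (y≗y' v)) allPt)

module Representation {c ℓ} (K : CommutativeRing c ℓ) (ζ s : CommutativeRing.Carrier K)
                      (q : ℕ) {{_ : NonZero q}} (D : ℕ) where
  open CommutativeRing K using (Carrier; _*_; 0#; 1#)
    renaming (refl to ≈-refl; trans to ≈-trans; reflexive to ≈-reflexive)
  open Rep K ζ s q D
  open FF q D
  open Matrices q D
  open Pullback q D
  open Action q D

  -- Subsets are Bool-valued predicates, so pointwise equal subsets need not be equal; the vectors
  -- used here only see subsets up to pointwise equality.
  Extensional : V → Set c
  Extensional φ = ∀ {y y' : Pred} → (∀ v → y v ≡ y' v) → φ y ≡ φ y'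

  ketI-cong : ∀ j {M M'} → M ≡M M' → ∀ {y y' : Pred} → (∀ v → y v ≡ y' v) → ketI j M y ≡ ketI j M' y'
  ketI-cong j {M} {M'} M≡M' {y} {y'} y≗y' =
    cong (powK s (j ℕ.* ℕ.suc j) *_) (cong sumK (map-cong term (List.filterᵇ (SymDB j) allMat)))
    where
    term : ∀ Fm → powK ζ (toℕ (tr (M *M Fm))) * ket (img I I Fm (xs j)) y
                ≡ powK ζ (toℕ (tr (M' *M Fm))) * ket (img I I Fm (xs j)) y'
    term Fm = cong₂ _*_ (cong (powK ζ ∘ toℕ) (sumF-cong (λ i → *M-congʳ Fm M≡M' i i)))
                        (cong (if_then 1# else 0#) (eqPredB-congʳ (img I I Fm (xs j)) y≗y'))

  ketI-extensional : ∀ j M → Extensional (ketI j M)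
  ketI-extensional j M = ketI-cong j {M} (λ _ _ → refl)

  ρC-∘G : ∀ A B {φ} → Extensional φ → ∀ y → ρC (A ∘G B) φ y ≡ ρC A (ρC B φ) y
  ρC-∘G A B φ-ext y = φ-ext (λ z → sym (img-∘ (inv B) (mat B) (inv A) (mat A) y z))

  ρC-cong : ∀ {A B φ} → mat A ≡M mat B → inv A ≡M inv B → Extensional φ → ∀ y → ρC A φ y ≡ ρC B φ y
  ρC-cong A≡B A⁻¹≡B⁻¹ φ-ext y = φ-ext (img-cong A⁻¹≡B⁻¹ A≡B y)

  span-precompose : ∀ {A B : Set} {G : A → V} {H : B → V} (h : Pred → Pred) (f : A → B) →
                    (∀ a y → H (f a) y ≡ G a (h y)) → ∀ {ψ} → InSpan G ψ → InSpan H (ψ ∘ h)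
  span-precompose {G = G} {H} h f Hf≡Gh (cs , ψ≈) =
    List.map (λ (k , a) → k , f a) cs , λ y → ≈-trans (ψ≈ (h y)) (≈-reflexive (cong sumK (begin
      List.map (λ (k , a) → k * G a (h y)) cs                        ≡⟨ map-cong (λ (k , a) → cong (k *_) (Hf≡Gh a y)) cs ⟨
      List.map (λ (k , a) → k * H (f a) y) cs                        ≡⟨ map-∘ cs ⟩
      List.map (λ (k , b) → k * H b y) (List.map (λ (k , a) → k , f a) cs) ∎)))
    where open ≡-Reasoning

  span-lift : ∀ {A B : Set} {G : A → V} {H : B → V} (h : Pred → Pred) (g : B → A) →
              (∀ b y → G (g b) (h y) ≡ H b y) →
              ∀ {φ} → InSpan H φ → Σ[ ψ ∈ V ] InSpan G ψ × φ ≈V (ψ ∘ h)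
  span-lift {A} {G = G} {H} h g Gg≡H (cs , φ≈) =
    (λ y → sumK (List.map (λ (k , a) → k * G a y) cs')) , (cs' , λ _ → ≈-refl) ,
    λ y → ≈-trans (φ≈ y) (≈-reflexive (cong sumK (begin
      List.map (λ (k , b) → k * H b y) cs                ≡⟨ map-cong (λ (k , b) → cong (k *_) (Gg≡H b y)) cs ⟨
      List.map (λ (k , b) → k * G (g b) (h y)) cs        ≡⟨ map-∘ cs ⟩
      List.map (λ (k , a) → k * G a (h y)) cs'           ∎)))
    where
    open ≡-Reasoning
    cs' : List (Carrier × A)
    cs' = List.map (λ (k , b) → k , g b) cs

  module _ (C : GL) (S : Mat) where

    gen-pushforward : Gen S → Gen (pullback (mat C) S)
    gen-pushforward (j , j≤D , B , sdB) =
      j , j≤D , invGL C ∘G B , SymD-resp {j} (λ a b → sym (pullback-inv C (mat B) S a b)) sdB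

    genV-pushforward : ∀ a y → genV (gen-pushforward a) y ≡ ρC (invGL C) (genV a) y
    genV-pushforward (j , _ , B , _) y = begin
      ρC (invGL C ∘G B) (ketI j (pullback (inv C *M mat B) (pullback (mat C) S))) y
        ≡⟨ ketI-cong j (pullback-inv C (mat B) S) (λ _ → refl) ⟩
      ρC (invGL C ∘G B) (ketI j (pullback (mat B) S)) y
        ≡⟨ ρC-∘G (invGL C) B (ketI-extensional j (pullback (mat B) S)) y ⟩
      ρC (invGL C) (ρC B (ketI j (pullback (mat B) S))) y ∎
      where open ≡-Reasoning

    gen-pullback : Gen (pullback (mat C) S) → Gen S
    gen-pullback (j , j≤D , B , sdB) =
      j , j≤D , C ∘G B , SymD-resp {j} (λ a b → sym (pullback-*M (mat C) (mat B) S a b)) sdB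

    genV-pullback : ∀ b y → ρC (invGL C) (genV (gen-pullback b)) y ≡ genV b y
    genV-pullback (j , _ , B , _) y = begin
      ρC (invGL C) (ρC (C ∘G B) (ketI j (pullback (mat C *M mat B) S))) y
        ≡⟨ ρC-∘G (invGL C) (C ∘G B) (ketI-extensional j (pullback (mat C *M mat B) S)) y ⟨
      ρC (invGL C ∘G (C ∘G B)) (ketI j (pullback (mat C *M mat B) S)) y
        ≡⟨ ρC-cong {invGL C ∘G (C ∘G B)} {B} (inv-*M-cancel C (mat B)) (*M-inv-cancel C (inv B))
                   (ketI-extensional j (pullback (mat C *M mat B) S)) y ⟩
      ρC B (ketI j (pullback (mat C *M mat B) S)) y
        ≡⟨ ketI-cong j (pullback-*M (mat C) (mat B) S) (λ _ → refl) ⟩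
      ρC B (ketI j (pullback (mat B) (pullback (mat C) S))) y ∎
      where open ≡-Reasoning

    ρW-pullback : SameSub (ρW (invGL C) S) (W (pullback (mat C) S))
    ρW-pullback φ = to , from
      where
      to : ρW (invGL C) S φ → W (pullback (mat C) S) φ
      to (ψ , ψ∈W , φ≈ρψ) =
        let cs , ρψ≈ = span-precompose (img (mat C) (inv C) 0M) gen-pushforward genV-pushforward ψ∈W
        in cs , λ y → ≈-trans (φ≈ρψ y) (ρψ≈ y)
      from : W (pullback (mat C) S) φ → ρW (invGL C) S φ
      from = span-lift (img (mat C) (inv C) 0M) gen-pullback genV-pullback

lemma4 : ∀ {c ℓ : Level} (K : CommutativeRing c ℓ) (ζ s : CommutativeRing.Carrier K)
         (q : ℕ) {{nz : NonZero q}} (D : ℕ)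
         → Prime q → 1 ≤ D
         → Rep.IsFieldK K ζ s q D → Rep.CharZero K ζ s q D
         → Rep.PrimRoot K ζ s q D → Rep.FourthRootInv K ζ s q D
         → (S : FF.Mat q D) → FF.Sym q D S
         → Σ[ i ∈ ℕ ] (i ≤ D) × Σ[ C ∈ FF.GL q D ] Σ[ S' ∈ FF.Mat q D ]
             FF.SymD q D i S' × FF.NonsingBlock q D i S'
             × Rep.SameSub K ζ s q D (Rep.ρW K ζ s q D C S) (Rep.W K ζ s q D S')
lemma4 K ζ s q D q-prime _ _ _ _ _ S symS =
  let i , i≤D , C , sd , nonsing = Reduction.reduction q D q-prime S symS
  in i , i≤D , FF.invGL q D C , Pullback.pullback q D (FF.mat C) S , sd , nonsing ,
     Representation.ρW-pullback K ζ s q D C S
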